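{- Let $\vec p$ be a list of propositional variables, $k$ an integer, and $A,B$ positive formulas. There are $\mathsf{posELNDT}$ proofs over the extension axioms $\mathcal T$ (together with the positive extension axioms of any further extension variables occurring in $A,B$), of size polynomial in the size of the respective sequent and of those further extension axioms, of: (1) $[t^{\vec p}_k\,|\,A\,|\,B]\to A,\ t^{\vec p}_k$; (2) $[t^{\vec p}_k\,|\,A\,|\,B]\to A,B$; (3) $A\to[t^{\vec p}_k\,|\,A\,|\,B]$; (4) $t^{\vec p}_k,\ B\to[t^{\vec p}_k\,|\,A\,|\,B]$.
   Context: eNDT formulas: built from propositional variables, constants $0,1$ and extension variables by $\vee$ and decisions $\mathrm{dec}(A,p,B)$ ("if $p$ then $B$ else $A$", $p$ a propositional variable, never an extension variable). $\mathrm{pd}(A,p,C):=\mathrm{dec}(A,p,A\vee C)$; positive formulas have only decisions of this form. An extension axiom $e\leftrightarrow A$ stands for sequents $e\to A$ and $A\to e$; systems of extension axioms must be well-founded (each variable defined in terms of earlier ones). $\mathcal T$ contains: for every list $\vec p$ of propositional variables and integer $k$, an extension variable $t^{\vec p}_k$ with axioms $t^{\epsilon}_0\leftrightarrow1$, $t^{\epsilon}_k\leftrightarrow0$ ($k\ne0$), $t^{p\vec p}_k\leftrightarrow\mathrm{pd}(t^{\vec p}_k,p,t^{\vec p}_{k-1})$ ($\epsilon$ empty list; $p\vec p$ = $\vec p$ with $p$ prepended); and, for every such $\vec p,k$ and positive formulas $A,B$, a single extension variable $[t^{\vec p}_k\,|\,A\,|\,B]$ (formulas and these variables being defined by mutual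 induction in well-founded stages) with axioms $[t^{\epsilon}_0|A|B]\leftrightarrow A\vee B$, $[t^{\epsilon}_k|A|B]\leftrightarrow A$ for $k\ne0$, and $[t^{p\vec p}_k|A|B]\leftrightarrow\mathrm{pd}([t^{\vec p}_k|A|B],p,[t^{\vec p}_{k-1}|A|B])$. $\mathsf{posELNDT}$: sequents on multisets; initial sequents $0\to$, $\to1$, $p\to p$; cut; left/right weakening and contraction; $\vee$-left (from $\Gamma,A\to\Delta$ and $\Gamma,B\to\Delta$ infer $\Gamma,A\vee B\to\Delta$); $\vee$-right (from $\Gamma\to\Delta,A,B$ infer $\Gamma\to\Delta,A\vee B$); positive decision left (from $\Gamma,A\to\Delta$ and $\Gamma,p,B\to\Delta$ infer $\Gamma,\mathrm{pd}(A,p,B)\to\Delta$) and right (from $\Gamma\to\Delta,A,p$ and $\Gamma\to\Delta,A,B$ infer $\Gamma\to\Delta,\mathrm{pd}(A,p,B)$); all formulas positive. A proof over a set of extension axioms: a finite list of sequents, each an axiom sequent or derived by a rule (conclusion may contain extension variables). Size = number of symbols. -}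

module Defs where

open import Data.Nat using (ℕ; zero; suc; _+_; _*_; _^_; _≤_; _<_)
open import Data.Integer using (ℤ; +_) renaming (_-_ to _-ℤ_)
open import Data.List using (List; []; _∷_; length; map)
open import Data.Nat.ListAction using (sum)
open import Data.List.Relation.Unary.All using (All)
open import Data.List.Membership.Propositional using (_∈_)
open import Data.List.Relation.Binary.Permutation.Propositional using (_↭_)
open import Data.Product using (Σ; _×_; _,_)
open import Data.Unit using (⊤)
open import Relation.Binary.PropositionalEquality using (_≡_)
open import Relation.Nullary using (¬_)

-- Formulas of eNDT
--   var p        : propositional variable p
--   c0, c1       : constants 0, 1
--   ext i        : a "further" extension variable (defined by entry i
--                  of a list of extension axioms, see below)
--   tv ps k      : the extension variable t^{ps}_k of 𝒯
--   bv ps k A B  : the extension variable [t^{ps}_k | A | B] of 𝒯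
--   A ∨ B        : disjunction
--   dec A p B    : "if p then B else A"

PVar : Set
PVar = ℕ

infixr 5 _∨_

data Formula : Set where
  var : PVar → Formula
  c0 c1 : Formula
  ext : ℕ → Formula
  tv  : List PVar → ℤ → Formula
  bv  : List PVar → ℤ → Formula → Formula → Formula
  _∨_ : Formula → Formula → Formula
  dec : Formula → PVar → Formula → Formula

pd : Formula → PVar → Formula → Formula
pd A p C = dec A p (A ∨ C)

data Pos : Formula → Set where
  var : ∀ p → Pos (var p)
  c0  : Pos c0
  c1  : Pos c1
  ext : ∀ i → Pos (ext i)
  tv  : ∀ ps k → Pos (tv ps k)
  bv  : ∀ ps k {A B} → Pos A → Pos B → Pos (bv ps k A B)
  or  : ∀ {A B} → Pos A → Pos B → Pos (A ∨ B)
  pdp : ∀ {A C} p → Pos A → Pos C → Pos (pd A p C)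

ExtBelow : ℕ → Formula → Set
ExtBelow n (var p) = ⊤
ExtBelow n c0 = ⊤
ExtBelow n c1 = ⊤
ExtBelow n (ext i) = i < n
ExtBelow n (tv ps k) = ⊤
ExtBelow n (bv ps k A B) = ExtBelow n A × ExtBelow n B
ExtBelow n (A ∨ B) = ExtBelow n A × ExtBelow n B
ExtBelow n (dec A p B) = ExtBelow n A × ExtBelow n B

-- Size = number of symbols.  An extension variable of 𝒯 is counted as
-- written out with its name: t^{ps}_k has 2 + |ps| symbols,
-- [t^{ps}_k | A | B] has 3 + |ps| + |A| + |B| symbols.

size : Formula → ℕ
size (var p) = 1
size c0 = 1
size c1 = 1
size (ext i) = 1
size (tv ps k) = 2 + length ps
size (bv ps k A B) = 3 + length ps + size A + size B
size (A ∨ B) = 1 + size A + size B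
size (dec A p B) = 2 + size A + size B

-- Sequents (on multisets: lists compared up to permutation)

infix 4 _⇒_
record Sequent : Set where
  constructor _⇒_
  field
    ant : List Formula
    succ : List Formula
open Sequent public

_≋_ : Sequent → Sequent → Set
S ≋ T = (ant S ↭ ant T) × (succ S ↭ succ T)

sizeSeq : Sequent → ℕ
sizeSeq (Γ ⇒ Δ) = 1 + sum (map size Γ) + sum (map size Δ)

PosSeq : Sequent → Set
PosSeq (Γ ⇒ Δ) = All Pos Γ × All Pos Δ

data TDef : Formula → Formula → Set where
  t-ε0 : TDef (tv [] (+ 0)) c1
  t-εk : ∀ {k} → ¬ (k ≡ + 0) → TDef (tv [] k) c0
  t-∷  : ∀ p ps k → TDef (tv (p ∷ ps) k) (pd (tv ps k) p (tv ps (k -ℤ + 1)))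
  b-ε0 : ∀ {A B} → Pos A → Pos B → TDef (bv [] (+ 0) A B) (A ∨ B)
  b-εk : ∀ {k A B} → Pos A → Pos B → ¬ (k ≡ + 0) → TDef (bv [] k A B) A
  b-∷  : ∀ p ps k {A B} → Pos A → Pos B →
         TDef (bv (p ∷ ps) k A B) (pd (bv ps k A B) p (bv ps (k -ℤ + 1) A B))

-- A list Ax of further extension axioms: ext i ↔ (entry i of Ax)
data _∋_↦_ : List Formula → ℕ → Formula → Set where
  here  : ∀ {D Ax} → (D ∷ Ax) ∋ 0 ↦ D
  there : ∀ {D E Ax i} → Ax ∋ i ↦ D → (E ∷ Ax) ∋ suc i ↦ D

WellFounded : List Formula → Set
WellFounded Ax = ∀ {i D} → Ax ∋ i ↦ D → Pos D × ExtBelow i D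

sizeAx : List Formula → ℕ
sizeAx Ax = sum (map (λ D → 3 + size D) Ax)

data AxiomSeq (Ax : List Formula) : Sequent → Set where
  tdef₁ : ∀ {e D} → TDef e D → AxiomSeq Ax ((e ∷ []) ⇒ (D ∷ []))
  tdef₂ : ∀ {e D} → TDef e D → AxiomSeq Ax ((D ∷ []) ⇒ (e ∷ []))
  xdef₁ : ∀ {i D} → Ax ∋ i ↦ D → AxiomSeq Ax ((ext i ∷ []) ⇒ (D ∷ []))
  xdef₂ : ∀ {i D} → Ax ∋ i ↦ D → AxiomSeq Ax ((D ∷ []) ⇒ (ext i ∷ []))

data Initial : Sequent → Set where
  ini0 : Initial ((c0 ∷ []) ⇒ [])
  ini1 : Initial ([] ⇒ (c1 ∷ []))
  iniv : ∀ p → Initial ((var p ∷ []) ⇒ (var p ∷ []))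

data Rule1 : Sequent → Sequent → Set where
  wkL  : ∀ {Γ Δ} A → Rule1 (Γ ⇒ Δ) ((A ∷ Γ) ⇒ Δ)
  wkR  : ∀ {Γ Δ} A → Rule1 (Γ ⇒ Δ) (Γ ⇒ (A ∷ Δ))
  ctrL : ∀ {Γ Δ A} → Rule1 ((A ∷ A ∷ Γ) ⇒ Δ) ((A ∷ Γ) ⇒ Δ)
  ctrR : ∀ {Γ Δ A} → Rule1 (Γ ⇒ (A ∷ A ∷ Δ)) (Γ ⇒ (A ∷ Δ))
  orR  : ∀ {Γ Δ A B} → Rule1 (Γ ⇒ (A ∷ B ∷ Δ)) (Γ ⇒ ((A ∨ B) ∷ Δ))

data Rule2 : Sequent → Sequent → Sequent → Set where
  cut : ∀ {Γ Δ A} → Rule2 (Γ ⇒ (A ∷ Δ)) ((A ∷ Γ) ⇒ Δ) (Γ ⇒ Δ)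
  orL : ∀ {Γ Δ A B} → Rule2 ((A ∷ Γ) ⇒ Δ) ((B ∷ Γ) ⇒ Δ) (((A ∨ B) ∷ Γ) ⇒ Δ)
  pdL : ∀ {Γ Δ A B p} →
        Rule2 ((A ∷ Γ) ⇒ Δ) ((var p ∷ B ∷ Γ) ⇒ Δ) ((pd A p B ∷ Γ) ⇒ Δ)
  pdR : ∀ {Γ Δ A B p} →
        Rule2 (Γ ⇒ (A ∷ var p ∷ Δ)) (Γ ⇒ (A ∷ B ∷ Δ)) (Γ ⇒ (pd A p B ∷ Δ))

data Justified (Ax : List Formula) (prev : List Sequent) (S : Sequent) : Set where
  init  : ∀ {C} → Initial C → C ≋ S → Justified Ax prev S
  axiom : ∀ {C} → AxiomSeq Ax C → C ≋ S → Justified Ax prev S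
  rule1 : ∀ {P P' C} → P ∈ prev → P ≋ P' → Rule1 P' C → C ≋ S →
          Justified Ax prev S
  rule2 : ∀ {P Q P' Q' C} → P ∈ prev → Q ∈ prev → P ≋ P' → Q ≋ Q' →
          Rule2 P' Q' C → C ≋ S → Justified Ax prev S

-- a proof is a finite list of sequents, stored latest-first: each line
-- is justified by the lines after it in the list (= earlier in the proof);
-- all formulas are positive
data Valid (Ax : List Formula) : List Sequent → Set where
  []  : Valid Ax []
  _∷_ : ∀ {S prev} → PosSeq S × Justified Ax prev S → Valid Ax prev →
        Valid Ax (S ∷ prev)

sizeProof : List Sequent → ℕ
sizeProof π = sum (map sizeSeq π)

record ProofOf (Ax : List Formula) (S : Sequent) : Set where
  constructor proof
  field
    earlier : List Sequent
    valid   : Valid Ax (S ∷ earlier)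

proofSize : ∀ {Ax S} → ProofOf Ax S → ℕ
proofSize {S = S} (proof e _) = sizeProof (S ∷ e)

PolyProvable : ℕ → ℕ → List Formula → Sequent → Set
PolyProvable c d Ax S =
  Σ (ProofOf Ax S) λ π → proofSize π ≤ c * (suc (sizeSeq S + sizeAx Ax)) ^ d

{-# OPTIONS --safe #-}
-- Unfolding the axioms of [t^{p ps}_k|A|B] and t^{p ps}_k once, the positive decision rules
-- reduce each of the four sequents for (p ps, k) to the same sequent for (ps, k) and (ps, k-1);
-- at ps = ε they follow from the base axioms and the identities A → A, B → B, which have
-- proofs linear in |A|, |B|.  Deriving the whole table of these sequents for the suffixes of ps
-- and the indices k, k-1, ..., k-|ps| bottom-up, each once although two successors use it,
-- gives O(|ps|²) lines of at most six formulas of size O(|[t|A|B]|): a cubic proof.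
module Submission where

open import Defs
open import Data.Bool using (T)
open import Data.Integer using (ℤ; +_; _-_) renaming (_≟_ to _≟ℤ_)
open import Data.List using (List; []; _∷_; length; map; _++_)
open import Data.List.Properties using (length-++)
open import Data.List.Membership.Propositional using (_∈_)
open import Data.List.Relation.Binary.Subset.Propositional using (_⊆_)
open import Data.List.Relation.Unary.All as All using (All; []; _∷_)
open import Data.List.Relation.Unary.All.Properties using (++⁺)
open import Data.List.Relation.Unary.Any using (here; there)
open import Data.List.Relation.Binary.Permutation.Propositional using (refl; prep; swap)
open import Data.Nat using (ℕ; zero; suc; _+_; _*_; _^_; _≤_; _<_; _≤ᵇ_; z≤n; s≤s)
open import Data.Nat.ListAction using (sum)
open import Data.Nat.Properties
open import Data.Nat.Tactic.RingSolver using (solve-∀)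
open import Data.Product using (Σ; _×_; _,_; proj₁)
open import Data.Sum using (_⊎_; inj₁; inj₂)
open import Relation.Binary.PropositionalEquality using (_≡_; refl; sym; cong₂)
open import Relation.Nullary using (yes; no)

≤-eval : ∀ {m n} → {T (m ≤ᵇ n)} → m ≤ n
≤-eval {m} {n} {t} = ≤ᵇ⇒≤ m n t

-- k ↓ i is k − i computed by i unit decrements, so that (k ↓ i) - + 1 is k ↓ suc i
-- by definition, matching the index shift in the axioms of t^{p ps}_k and [t^{p ps}_k|A|B].
_↓_ : ℤ → ℕ → ℤ
k ↓ zero = k
k ↓ suc i = (k ↓ i) - + 1

1≤size : ∀ F → 1 ≤ size F
1≤size (var p) = s≤s z≤n
1≤size c0 = s≤s z≤n
1≤size c1 = s≤s z≤n
1≤size (ext i) = s≤s z≤n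
1≤size (tv ps k) = s≤s z≤n
1≤size (bv ps k A B) = s≤s z≤n
1≤size (A ∨ B) = s≤s z≤n
1≤size (dec A p B) = s≤s z≤n

size≤sum : ∀ {F Γ} → F ∈ Γ → size F ≤ sum (map size Γ)
size≤sum (here refl) = m≤m+n _ _
size≤sum {Γ = G ∷ Γ} (there F∈Γ) = ≤-trans (size≤sum F∈Γ) (m≤n+m _ (size G))

size≤sizeSeq : ∀ {F Γ Δ} → F ∈ Γ ⊎ F ∈ Δ → size F ≤ sizeSeq (Γ ⇒ Δ)
size≤sizeSeq (inj₁ F∈Γ) = ≤-trans (size≤sum F∈Γ) (≤-trans (m≤m+n _ _) (n≤1+n _))
size≤sizeSeq {Γ = Γ} (inj₂ F∈Δ) =
  ≤-trans (size≤sum F∈Δ) (≤-trans (m≤n+m _ (sum (map size Γ))) (n≤1+n _))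

definitionOf : ∀ Ax i → i < length Ax → Σ Formula (Ax ∋ i ↦_)
definitionOf (D ∷ Ax) zero _ = D , here
definitionOf (D ∷ Ax) (suc i) (s≤s i<n) with definitionOf Ax i i<n
... | D' , def = D' , there def

size≤sizeAx : ∀ {Ax i D} → Ax ∋ i ↦ D → size D ≤ sizeAx Ax
size≤sizeAx {D ∷ Ax} here = ≤-trans (m≤n+m (size D) 3) (m≤m+n _ _)
size≤sizeAx {E ∷ Ax} (there def) = ≤-trans (size≤sizeAx def) (m≤n+m _ (3 + size E))

module Derivations (Ax : List Formula) (K : ℕ) where

  Small : Formula → Set
  Small F = Pos F × size F ≤ K

  Fits : Sequent → Set
  Fits S = PosSeq S × sizeSeq S ≤ suc (6 * K)

  sum-size≤ : ∀ {Γ} → All Small Γ → sum (map size Γ) ≤ length Γ * K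
  sum-size≤ [] = z≤n
  sum-size≤ ((_ , s) ∷ sΓ) = +-mono-≤ s (sum-size≤ sΓ)

  fits-≤6 : ∀ {Γ Δ} → All Small Γ → All Small Δ → length Γ + length Δ ≤ 6 → Fits (Γ ⇒ Δ)
  fits-≤6 {Γ} {Δ} sΓ sΔ w = (All.map proj₁ sΓ , All.map proj₁ sΔ) , s≤s (begin
      sum (map size Γ) + sum (map size Δ) ≤⟨ +-mono-≤ (sum-size≤ sΓ) (sum-size≤ sΔ) ⟩
      length Γ * K + length Δ * K          ≡⟨ *-distribʳ-+ K (length Γ) (length Δ) ⟨
      (length Γ + length Δ) * K            ≤⟨ *-monoˡ-≤ K w ⟩
      6 * K                                ∎)
    where open ≤-Reasoning

  fits : ∀ {Γ Δ} → All Small Γ → All Small Δ → {T (length Γ + length Δ ≤ᵇ 6)} → Fits (Γ ⇒ Δ)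
  fits sΓ sΔ {t} = fits-≤6 sΓ sΔ (≤ᵇ⇒≤ _ _ t)

  SmallContext : List Formula → List Formula → ℕ → Set
  SmallContext Γ Δ k = All Small Γ × All Small Δ × length Γ + length Δ ≤ k

  fitsAround : ∀ {Γ Δ k Γ' Δ'} → SmallContext Γ Δ k → All Small Γ' → All Small Δ' →
               {T (length Γ' + length Δ' + k ≤ᵇ 6)} → Fits ((Γ' ++ Γ) ⇒ (Δ' ++ Δ))
  fitsAround {Γ} {Δ} {k} {Γ'} {Δ'} (sΓ , sΔ , w) sΓ' sΔ' {t} =
    fits-≤6 (++⁺ sΓ' sΓ) (++⁺ sΔ' sΔ) (begin
      length (Γ' ++ Γ) + length (Δ' ++ Δ)             ≡⟨ cong₂ _+_ (length-++ Γ') (length-++ Δ') ⟩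
      (length Γ' + length Γ) + (length Δ' + length Δ) ≡⟨ interchange (length Γ') _ (length Δ') _ ⟩
      (length Γ' + length Δ') + (length Γ + length Δ) ≤⟨ +-monoʳ-≤ _ w ⟩
      length Γ' + length Δ' + k                       ≤⟨ ≤ᵇ⇒≤ _ _ t ⟩
      6                                               ∎)
    where
    open ≤-Reasoning
    interchange : ∀ a m b n → (a + m) + (b + n) ≡ (a + b) + (m + n)
    interchange = solve-∀

  relax : ∀ {Γ Δ k k'} → k ≤ k' → SmallContext Γ Δ k → SmallContext Γ Δ k'
  relax k≤k' (sΓ , sΔ , w) = sΓ , sΔ , ≤-trans w k≤k'

  consʳ : ∀ {Γ Δ k Y} → Small Y → SmallContext Γ Δ k → SmallContext Γ (Y ∷ Δ) (suc k)
  consʳ {Γ} {Δ} sY (sΓ , sΔ , w) =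
    sΓ , sY ∷ sΔ , ≤-trans (≤-reflexive (+-suc (length Γ) (length Δ))) (s≤s w)

  pd-small⁻ : ∀ {Y p Y'} → Small (pd Y p Y') → Small (var p) × Small Y × Small Y'
  pd-small⁻ {Y} {p} {Y'} (pdp _ pY pY' , s) =
    (var p , ≤-trans (s≤s z≤n) s) ,
    (pY , ≤-trans (≤-trans (m≤n+m (size Y) 2) (m≤m+n _ _)) s) ,
    (pY' , ≤-trans (≤-trans (m≤n+m (size Y') (suc (size Y))) (m≤n+m _ (2 + size Y))) s)

  data SmallProof : List Sequent → Set where
    [] : SmallProof []
    _∷_ : ∀ {S L} → Fits S × Justified Ax L S → SmallProof L → SmallProof (S ∷ L)

  toValid : ∀ {L} → SmallProof L → Valid Ax L
  toValid [] = []
  toValid (((pos , _) , j) ∷ π) = (pos , j) ∷ toValid π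

  sizeProof≤ : ∀ {L} → SmallProof L → sizeProof L ≤ length L * suc (6 * K)
  sizeProof≤ [] = z≤n
  sizeProof≤ (((_ , s) , _) ∷ π) = +-mono-≤ s (sizeProof≤ π)

  record Extension (L : List Sequent) (c : ℕ) (P : List Sequent → Set) : Set where
    constructor extension
    field
      {lines} : List Sequent
      derivation : SmallProof lines
      keeps : L ⊆ lines
      bounded : length lines ≤ c + length L
      result : P lines

  return : ∀ {L P} → SmallProof L → P L → Extension L 0 P
  return π p = extension π (λ S∈L → S∈L) ≤-refl p

  infixr 1 _>>=_
  _>>=_ : ∀ {L c d P Q} → Extension L c P →
          (∀ {L'} → SmallProof L' → L ⊆ L' → P L' → Extension L' d Q) → Extension L (d + c) Q
  _>>=_ {L} {c} {d} (extension π keeps bounded p) continue with continue π keeps p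
  ... | extension π' keeps' bounded' q =
    extension π' (λ S∈L → keeps' (keeps S∈L))
      (≤-trans bounded' (≤-trans (+-monoʳ-≤ d bounded) (≤-reflexive (sym (+-assoc d c (length L)))))) q

  weaken : ∀ {L c c' P} → c ≤ c' → Extension L c P → Extension L c' P
  weaken {L} c≤c' (extension π keeps bounded p) =
    extension π keeps (≤-trans bounded (+-monoˡ-≤ (length L) c≤c')) p

  line : ∀ {L S} → SmallProof L → Fits S → Justified Ax L S → Extension L 1 (S ∈_)
  line π fit j = extension ((fit , j) ∷ π) there ≤-refl (here refl)

  ≋-refl : ∀ {S} → S ≋ S
  ≋-refl = refl , refl

  by₁ : ∀ {L P S} → Rule1 P S → P ∈ L → Justified Ax L S
  by₁ r P∈L = rule1 P∈L ≋-refl r ≋-refl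

  by₂ : ∀ {L P Q S} → Rule2 P Q S → P ∈ L → Q ∈ L → Justified Ax L S
  by₂ r P∈L Q∈L = rule2 P∈L Q∈L ≋-refl ≋-refl r ≋-refl

  weakenedLeaf : ∀ {L X Y} Γ Δ → Small X → Small Y → SmallContext Γ Δ 4 →
                 (∀ {L'} → Justified Ax L' ((X ∷ []) ⇒ (Y ∷ []))) → SmallProof L →
                 Extension L (suc (length Γ + length Δ)) (((X ∷ Γ) ⇒ (Y ∷ Δ)) ∈_)
  weakenedLeaf [] [] sX sY _ leaf π = line π (fits (sX ∷ []) (sY ∷ [])) leaf
  weakenedLeaf {Y = Y} [] (Z ∷ Δ) sX sY ctx@([] , sZ ∷ sΔ , w) leaf π =
    weakenedLeaf [] Δ sX sY ([] , sΔ , ≤-trans (n≤1+n _) w) leaf π >>= λ π₁ _ h →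
    line π₁ (fitsAround ctx (sX ∷ []) (sY ∷ [])) (rule1 h ≋-refl (wkR Z) (refl , swap Z Y refl))
  weakenedLeaf {X = X} (Z ∷ Γ) Δ sX sY ctx@(sZ ∷ sΓ , sΔ , w) leaf π =
    weakenedLeaf Γ Δ sX sY (sΓ , sΔ , ≤-trans (n≤1+n _) w) leaf π >>= λ π₁ _ h →
    line π₁ (fitsAround ctx (sX ∷ []) (sY ∷ [])) (rule1 h ≋-refl (wkL Z) (swap Z X refl , refl))

  axiomCutˡ : ∀ {L Γ Δ X Y} → Small X → Small Y → SmallContext Γ Δ 2 →
              AxiomSeq Ax ((X ∷ []) ⇒ (Y ∷ [])) → SmallProof L → ((Y ∷ Γ) ⇒ Δ) ∈ L →
              Extension L (3 + (length Γ + length Δ)) (((X ∷ Γ) ⇒ Δ) ∈_)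
  axiomCutˡ {Γ = Γ} {Δ} {X} {Y} sX sY ctx ax π h =
    weakenedLeaf Γ Δ sX sY (relax ≤-eval ctx) (axiom ax ≋-refl) π >>= λ π₁ keep₁ h₁ →
    line π₁ (fitsAround ctx (sX ∷ sY ∷ []) []) (by₁ (wkL X) (keep₁ h)) >>= λ π₂ keep₂ h₂ →
    line π₂ (fitsAround ctx (sX ∷ []) []) (rule2 (keep₂ h₁) h₂ ≋-refl (swap X Y refl , refl) cut ≋-refl)

  axiomCutʳ : ∀ {L Γ Δ X Y} → Small X → Small Y → SmallContext Γ Δ 2 →
              AxiomSeq Ax ((X ∷ []) ⇒ (Y ∷ [])) → SmallProof L → (Γ ⇒ (X ∷ Δ)) ∈ L →
              Extension L (3 + (length Γ + length Δ)) ((Γ ⇒ (Y ∷ Δ)) ∈_)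
  axiomCutʳ {Γ = Γ} {Δ} {X} {Y} sX sY ctx ax π h =
    weakenedLeaf Γ Δ sX sY (relax ≤-eval ctx) (axiom ax ≋-refl) π >>= λ π₁ keep₁ h₁ →
    line π₁ (fitsAround ctx [] (sY ∷ sX ∷ [])) (by₁ (wkR Y) (keep₁ h)) >>= λ π₂ keep₂ h₂ →
    line π₂ (fitsAround ctx [] (sY ∷ [])) (rule2 h₂ (keep₂ h₁) (refl , swap Y X refl) ≋-refl cut ≋-refl)

  pdR-else : ∀ {L Γ Δ Y Y'} p → Small (pd Y p Y') → SmallContext Γ Δ 2 → SmallProof L →
           (Γ ⇒ (Y ∷ Δ)) ∈ L → Extension L 3 ((Γ ⇒ (pd Y p Y' ∷ Δ)) ∈_)
  pdR-else {Y = Y} {Y'} p sD ctx π h with pd-small⁻ sD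
  ... | sp , sY , sY' =
    line π (fitsAround ctx [] (sY ∷ sp ∷ []))
      (rule1 h ≋-refl (wkR (var p)) (refl , swap (var p) Y refl)) >>= λ π₁ keep₁ h₁ →
    line π₁ (fitsAround ctx [] (sY ∷ sY' ∷ []))
      (rule1 (keep₁ h) ≋-refl (wkR Y') (refl , swap Y' Y refl)) >>= λ π₂ keep₂ h₂ →
    line π₂ (fitsAround ctx [] (sD ∷ [])) (by₂ pdR (keep₂ h₁) h₂)

  pdR-then : ∀ {L Γ Δ Y Y'} p → Small (pd Y p Y') → SmallContext Γ Δ 2 → SmallProof L →
            (Γ ⇒ (Y' ∷ Δ)) ∈ L →
            Extension L (4 + (length Γ + length (Y ∷ Δ))) (((var p ∷ Γ) ⇒ (pd Y p Y' ∷ Δ)) ∈_)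
  pdR-then {Γ = Γ} {Δ} {Y} {Y'} p sD ctx π h with pd-small⁻ sD
  ... | sp , sY , sY' =
    weakenedLeaf Γ (Y ∷ Δ) sp sp (relax ≤-eval (consʳ sY ctx)) (init (iniv p) ≋-refl) π >>= λ π₁ keep₁ h₁ →
    line π₁ (fitsAround ctx (sp ∷ []) (sY' ∷ [])) (by₁ (wkL (var p)) (keep₁ h)) >>= λ π₂ keep₂ h₂ →
    line π₂ (fitsAround ctx (sp ∷ []) (sY ∷ sY' ∷ [])) (by₁ (wkR Y) h₂) >>= λ π₃ keep₃ h₃ →
    line π₃ (fitsAround ctx (sp ∷ []) (sD ∷ []))
      (rule2 (keep₃ (keep₂ h₁)) h₃ (refl , swap (var p) Y refl) ≋-refl pdR ≋-refl)

  extendRow : ∀ {Q : ℕ → Sequent} {r L} →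
              (∀ i → i < r → Q i ∈ L) → Q r ∈ L → ∀ i → i < suc r → Q i ∈ L
  extendRow row h i i<1+r with m<1+n⇒m<n∨m≡n i<1+r
  ... | inj₁ i<r = row i i<r
  ... | inj₂ refl = h

  tabulate : ∀ {L₀ c} (Q : ℕ → Sequent) r → SmallProof L₀ →
             (∀ {L} → SmallProof L → L₀ ⊆ L → ∀ i → i < r → Extension L c (Q i ∈_)) →
             Extension L₀ (r * c) (λ L → ∀ i → i < r → Q i ∈ L)
  tabulate Q zero π body = return π (λ _ ())
  tabulate Q (suc r) π body =
    tabulate Q r π (λ π' keep i i<r → body π' keep i (m<n⇒m<1+n i<r)) >>= λ π₁ keep₁ row →
    body π₁ keep₁ r ≤-refl >>= λ π₂ keep₂ h →
    return π₂ (extendRow (λ i i<r → keep₂ (row i i<r)) h)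

  -- A proof must end with its goal, so the goal is derived once more by weakening and contraction.
  conclude : ∀ {c P Γ D Δ} → Extension [] c (P ∈_) → P ≋ (Γ ⇒ (D ∷ Δ)) →
             Fits (Γ ⇒ (D ∷ D ∷ Δ)) → Fits (Γ ⇒ (D ∷ Δ)) →
             Σ (ProofOf Ax (Γ ⇒ (D ∷ Δ))) λ π → proofSize π ≤ (2 + c) * suc (6 * K)
  conclude {c} {Γ = Γ} {D} {Δ} (extension {L} π _ bounded P∈L) (ant≋ , succ≋) fit₂ fit₁ =
    proof (_ ∷ L) (toValid π') ,
    ≤-trans (sizeProof≤ π')
      (*-monoˡ-≤ (suc (6 * K)) (s≤s (s≤s (≤-trans bounded (≤-reflexive (+-identityʳ c))))))
    where
    π' : SmallProof ((Γ ⇒ (D ∷ Δ)) ∷ (Γ ⇒ (D ∷ D ∷ Δ)) ∷ L)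
    π' = (fit₁ , by₁ ctrR (here refl))
       ∷ (fit₂ , rule1 P∈L ≋-refl (wkR D) (ant≋ , prep D succ≋))
       ∷ π

module SizeBounded (Ax : List Formula) (W : ℕ) (3≤W : 3 ≤ W) (wf : WellFounded Ax)
                   (definitions≤W : ∀ {i D} → Ax ∋ i ↦ D → size D ≤ W) where

  open Derivations Ax (4 * W) public

  small : ∀ {F} → Pos F → size F ≤ W → Small F
  small pF s = pF , ≤-trans s (m≤m+n W _)

  pd-small : ∀ {X Y} p → Pos X → Pos Y → size X ≤ W → size Y ≤ W → Small (pd X p Y)
  pd-small {X} {Y} p pX pY sX sY = pdp p pX pY , (begin
      2 + size X + (1 + size X + size Y) ≤⟨ +-mono-≤ (+-monoʳ-≤ 2 sX) (+-mono-≤ (+-monoʳ-≤ 1 sX) sY) ⟩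
      2 + W + (1 + W + W)                ≡⟨ regroup W ⟩
      3 + 3 * W                          ≤⟨ +-monoˡ-≤ (3 * W) 3≤W ⟩
      W + 3 * W                          ∎)
    where
    open ≤-Reasoning
    regroup : ∀ w → 2 + w + (1 + w + w) ≡ 3 + 3 * w
    regroup = solve-∀

  unit-small : ∀ {F} → Pos F → size F ≤ 1 → Small F
  unit-small pF s = small pF (≤-trans s (≤-trans (s≤s z≤n) 3≤W))

  definedIdentity : ∀ {L e D} → Small e → Small D → AxiomSeq Ax ((e ∷ []) ⇒ (D ∷ [])) →
                    AxiomSeq Ax ((D ∷ []) ⇒ (e ∷ [])) → SmallProof L →
                    Extension L (10 * size e) (((e ∷ []) ⇒ (e ∷ [])) ∈_)
  definedIdentity {e = e} se sD unfold fold π =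
    weaken (≤-trans (≤-eval {5} {10}) (*-monoʳ-≤ 10 (1≤size e))) (
      line π (fits (se ∷ []) (sD ∷ [])) (axiom unfold ≋-refl) >>= λ π₁ _ h →
      axiomCutʳ sD se (se ∷ [] , [] , ≤-eval) fold π₁ h)

  identity : ∀ {F L} → Pos F → size F ≤ W → ExtBelow (length Ax) F → SmallProof L →
             Extension L (10 * size F) (((F ∷ []) ⇒ (F ∷ [])) ∈_)
  identity (var p) _ _ π =
    weaken ≤-eval (line π (fits (sp ∷ []) (sp ∷ [])) (init (iniv p) ≋-refl))
    where sp = unit-small (var p) ≤-refl
  identity c0 _ _ π =
    weaken ≤-eval (
      line π (fits (s0 ∷ []) []) (init ini0 ≋-refl) >>= λ π₁ _ h →
      line π₁ (fits (s0 ∷ []) (s0 ∷ [])) (by₁ (wkR c0) h))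
    where s0 = unit-small c0 ≤-refl
  identity c1 _ _ π =
    weaken ≤-eval (
      line π (fits [] (s1 ∷ [])) (init ini1 ≋-refl) >>= λ π₁ _ h →
      line π₁ (fits (s1 ∷ []) (s1 ∷ [])) (by₁ (wkL c1) h))
    where s1 = unit-small c1 ≤-refl
  identity (ext i) s i<n π with definitionOf Ax i i<n
  ... | D , def = definedIdentity (small (ext i) s) (small (proj₁ (wf def)) (definitions≤W def))
                    (xdef₁ def) (xdef₂ def) π
  identity (tv [] k) s _ π with k ≟ℤ + 0
  ... | yes refl = definedIdentity (small (tv [] k) s) (unit-small c1 ≤-refl) (tdef₁ t-ε0) (tdef₂ t-ε0) π
  ... | no k≢0 = definedIdentity (small (tv [] k) s) (unit-small c0 ≤-refl)
                   (tdef₁ (t-εk k≢0)) (tdef₂ (t-εk k≢0)) π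
  identity (tv (p ∷ ps) k) s _ π =
    definedIdentity (small (tv (p ∷ ps) k) s) (pd-small p (tv ps k) (tv ps _) s' s')
      (tdef₁ (t-∷ p ps k)) (tdef₂ (t-∷ p ps k)) π
    where s' = ≤-trans (n≤1+n _) s
  identity (bv [] k {A} {B} pA pB) s _ π with k ≟ℤ + 0
  ... | yes refl = definedIdentity (small (bv [] k pA pB) s)
                     (small (or pA pB) (≤-trans (+-monoˡ-≤ (size B) (+-monoˡ-≤ (size A) (s≤s z≤n))) s))
                     (tdef₁ (b-ε0 pA pB)) (tdef₂ (b-ε0 pA pB)) π
  ... | no k≢0 = definedIdentity (small (bv [] k pA pB) s)
                   (small pA (≤-trans (≤-trans (m≤n+m (size A) 3) (m≤m+n _ (size B))) s))
                   (tdef₁ (b-εk pA pB k≢0)) (tdef₂ (b-εk pA pB k≢0)) π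
  identity (bv (p ∷ ps) k {A} {B} pA pB) s _ π =
    definedIdentity (small (bv (p ∷ ps) k pA pB) s) (pd-small p (bv ps k pA pB) (bv ps _ pA pB) s' s')
      (tdef₁ (b-∷ p ps k pA pB)) (tdef₂ (b-∷ p ps k pA pB)) π
    where s' = ≤-trans (+-monoˡ-≤ (size B) (+-monoˡ-≤ (size A) (n≤1+n _))) s
  identity (or {F} {H} pF pH) s (eF , eH) π =
    weaken (or-cost (size F) (size H)) (
      identity pF sF eF π >>= λ π₁ keep₁ hF →
      identity pH sH eH π₁ >>= λ π₂ keep₂ hH →
      line π₂ (fits (gF ∷ []) (gF ∷ gH ∷ []))
        (rule1 (keep₂ hF) ≋-refl (wkR H) (refl , swap H F refl)) >>= λ π₃ keep₃ h₃ →
      line π₃ (fits (gF ∷ []) (gFH ∷ [])) (by₁ orR h₃) >>= λ π₄ keep₄ h₄ →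
      line π₄ (fits (gH ∷ []) (gF ∷ gH ∷ [])) (by₁ (wkR F) (keep₄ (keep₃ hH))) >>= λ π₅ keep₅ h₅ →
      line π₅ (fits (gH ∷ []) (gFH ∷ [])) (by₁ orR h₅) >>= λ π₆ keep₆ h₆ →
      line π₆ (fits (gFH ∷ []) (gFH ∷ [])) (by₂ orL (keep₆ (keep₅ h₄)) h₆))
    where
    sF = ≤-trans (≤-trans (m≤m+n (size F) (size H)) (n≤1+n _)) s
    sH = ≤-trans (≤-trans (m≤n+m (size H) (size F)) (n≤1+n _)) s
    gF = small pF sF
    gH = small pH sH
    gFH = small (or pF pH) s
    or-cost : ∀ x y → 5 + 10 * y + 10 * x ≤ 10 * (1 + x + y)
    or-cost x y = ≤-trans (m≤m+n _ 5) (≤-reflexive (slack x y))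
      where
      slack : ∀ x y → 5 + 10 * y + 10 * x + 5 ≡ 10 * (1 + x + y)
      slack = solve-∀
  identity (pdp {X} {C} p pX pC) s (eX , _ , eC) π =
    weaken (pd-cost (size X) (size C)) (
      identity pX sX eX π >>= λ π₁ keep₁ hX →
      identity pC sC eC π₁ >>= λ π₂ keep₂ hC →
      pdR-else p gD (gX ∷ [] , [] , ≤-eval) π₂ (keep₂ hX) >>= λ π₃ keep₃ h₃ →
      pdR-then p gD (gC ∷ [] , [] , ≤-eval) π₃ (keep₃ hC) >>= λ π₄ keep₄ h₄ →
      line π₄ (fits (gD ∷ []) (gD ∷ [])) (by₂ pdL (keep₄ h₃) h₄))
    where
    sX = ≤-trans (≤-trans (m≤n+m (size X) 2) (m≤m+n _ _)) s
    sC = ≤-trans (≤-trans (m≤n+m (size C) (suc (size X))) (m≤n+m _ (2 + size X))) s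
    gX = small pX sX
    gC = small pC sC
    gD = pd-small p pX pC sX sC
    pd-cost : ∀ x y → 10 + 10 * y + 10 * x ≤ 10 * (2 + x + (1 + x + y))
    pd-cost x y = ≤-trans (m≤m+n _ (20 + 10 * x)) (≤-reflexive (slack x y))
      where
      slack : ∀ x y → 10 + 10 * y + 10 * x + (20 + 10 * x) ≡ 10 * (2 + x + (1 + x + y))
      slack = solve-∀

-- At most 2 + 21w² + 20w ≤ 43w² lines of size at most 1 + 24w ≤ 25w, where w = 1 + u.
cubicBound : ∀ {a b m u N} → a ≤ suc u → b ≤ suc u → m ≤ suc u → suc u ≤ N →
             (2 + (m * (m * 21) + 10 * b + 10 * a)) * suc (6 * (4 * suc u)) ≤ 1075 * N ^ 3
cubicBound {a} {b} {m} {u} {N} a≤w b≤w m≤w w≤N = begin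
  (2 + (m * (m * 21) + 10 * b + 10 * a)) * suc (6 * (4 * w))
    ≤⟨ *-mono-≤ lineCount lineSize ⟩
  (2 + (w * (w * 21) + 10 * w + 10 * w) + (22 * (u * u) + 24 * u)) * (suc (6 * (4 * w)) + u)
    ≡⟨ product u ⟩
  1075 * w ^ 3
    ≤⟨ *-monoʳ-≤ 1075 (^-monoˡ-≤ 3 w≤N) ⟩
  1075 * N ^ 3 ∎
  where
  open ≤-Reasoning
  w = suc u
  lineCount : 2 + (m * (m * 21) + 10 * b + 10 * a) ≤
              2 + (w * (w * 21) + 10 * w + 10 * w) + (22 * (u * u) + 24 * u)
  lineCount = ≤-trans (+-monoʳ-≤ 2 (+-mono-≤ (+-mono-≤ (*-mono-≤ m≤w (*-monoˡ-≤ 21 m≤w)) (*-monoʳ-≤ 10 b≤w))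
                                               (*-monoʳ-≤ 10 a≤w)))
                      (m≤m+n _ _)
  lineSize : suc (6 * (4 * w)) ≤ suc (6 * (4 * w)) + u
  lineSize = m≤m+n _ u
  product : ∀ u → (2 + ((1 + u) * ((1 + u) * 21) + 10 * (1 + u) + 10 * (1 + u))
                        + (22 * (u * u) + 24 * u)) * (1 + 6 * (4 * (1 + u)) + u)
                  ≡ 1075 * ((1 + u) * ((1 + u) * ((1 + u) * 1)))
  product = solve-∀

module Families (Ax : List Formula) {A B : Formula} (pA : Pos A) (pB : Pos B) (wf : WellFounded Ax)
                (eA : ExtBelow (length Ax) A) (eB : ExtBelow (length Ax) B)
                (ps₀ : List PVar) (k₀ : ℤ) where

  n : ℕ
  n = length ps₀

  W : ℕ
  W = size (bv ps₀ k₀ A B) + sizeAx Ax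

  open SizeBounded Ax W (s≤s (s≤s (s≤s z≤n))) wf (λ def → ≤-trans (size≤sizeAx def) (m≤n+m _ _))

  bv₀≤W : size (bv ps₀ k₀ A B) ≤ W
  bv₀≤W = m≤m+n _ _

  3+n≤W : 3 + n ≤ W
  3+n≤W = ≤-trans (≤-trans (m≤m+n _ (size A)) (m≤m+n _ (size B))) bv₀≤W

  bv≤W : ∀ {ps k} → length ps ≤ n → size (bv ps k A B) ≤ W
  bv≤W ℓ = ≤-trans (+-monoˡ-≤ (size B) (+-monoˡ-≤ (size A) (+-monoʳ-≤ 3 ℓ))) bv₀≤W

  tv≤W : ∀ {ps k} → length ps ≤ n → size (tv ps k) ≤ W
  tv≤W ℓ = ≤-trans (+-monoʳ-≤ 2 ℓ) (≤-trans (n≤1+n _) 3+n≤W)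

  1+n≤W : suc n ≤ W
  1+n≤W = ≤-trans (≤-trans (n≤1+n _) (n≤1+n _)) 3+n≤W

  A≤W : size A ≤ W
  A≤W = ≤-trans (≤-trans (m≤n+m (size A) (3 + n)) (m≤m+n _ (size B))) bv₀≤W

  B≤W : size B ≤ W
  B≤W = ≤-trans (m≤n+m (size B) _) bv₀≤W

  sA : Small A
  sA = small pA A≤W

  sB : Small B
  sB = small pB B≤W

  sA∨B : Small (A ∨ B)
  sA∨B = small (or pA pB) (≤-trans (+-monoˡ-≤ (size B) (+-monoˡ-≤ (size A) (s≤s z≤n))) bv₀≤W)

  sbv : ∀ {ps k} → length ps ≤ n → Small (bv ps k A B)
  sbv {ps} {k} ℓ = small (bv ps k pA pB) (bv≤W {ps} {k} ℓ)

  stv : ∀ {ps k} → length ps ≤ n → Small (tv ps k)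
  stv {ps} {k} ℓ = small (tv ps k) (tv≤W {ps} {k} ℓ)

  sDbv : ∀ {p ps k} → length (p ∷ ps) ≤ n → Small (pd (bv ps k A B) p (bv ps (k - + 1) A B))
  sDbv {p} {ps} {k} ℓ =
    pd-small p (bv ps k pA pB) (bv ps _ pA pB) (bv≤W {ps} {k} ℓ') (bv≤W {ps} {k - + 1} ℓ')
    where ℓ' = ≤-trans (n≤1+n _) ℓ

  sDtv : ∀ {p ps k} → length (p ∷ ps) ≤ n → Small (pd (tv ps k) p (tv ps (k - + 1)))
  sDtv {p} {ps} {k} ℓ = pd-small p (tv ps k) (tv ps _) (tv≤W {ps} {k} ℓ') (tv≤W {ps} {k - + 1} ℓ')
    where ℓ' = ≤-trans (n≤1+n _) ℓ

  Family : Set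
  Family = List PVar → ℤ → Sequent

  Identities : List Sequent → Set
  Identities L = ((A ∷ []) ⇒ (A ∷ [])) ∈ L × ((B ∷ []) ⇒ (B ∷ [])) ∈ L

  Base : Family → Set
  Base F = ∀ {L} → SmallProof L → Identities L → ∀ k → Extension L 21 (F [] k ∈_)

  Step : Family → Set
  Step F = ∀ {L} → SmallProof L → ∀ p ps k → length (p ∷ ps) ≤ n →
           F ps k ∈ L → F ps (k - + 1) ∈ L → Extension L 21 (F (p ∷ ps) k ∈_)

  Row : Family → List PVar → ℕ → List Sequent → Set
  Row F ps r L = ∀ i → i < r → F ps (k₀ ↓ i) ∈ L

  rowCost : ℕ
  rowCost = suc n * 21

  -- The row of p ∷ ps is computed from the row of ps, which must be one entry longer.
  row : ∀ {F L} → Base F → Step F → ∀ ps r → length ps + r ≤ n → SmallProof L → Identities L →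
        Extension L (suc (length ps) * rowCost) (Row F ps (suc r))
  row base step [] r ℓ π (iA , iB) =
    weaken (≤-trans (*-monoˡ-≤ 21 (s≤s ℓ)) (≤-reflexive (sym (+-identityʳ rowCost))))
      (tabulate _ (suc r) π (λ π' keep i _ → base π' (keep iA , keep iB) (k₀ ↓ i)))
  row base step (p ∷ ps) r ℓ π ids =
    row base step ps (suc r) (≤-trans (≤-reflexive (+-suc (length ps) r)) ℓ) π ids >>= λ π₁ _ previous →
    weaken (*-monoˡ-≤ 21 (s≤s (≤-trans (m≤n+m r _) ℓ)))
      (tabulate _ (suc r) π₁ (λ π' keep i i<1+r →
        step π' p ps (k₀ ↓ i) (≤-trans (m≤m+n _ r) ℓ)
             (keep (previous i (m<n⇒m<1+n i<1+r))) (keep (previous (suc i) (s≤s i<1+r)))))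

  derive : ∀ {F} → Base F → Step F →
           Extension [] (suc n * rowCost + 10 * size B + 10 * size A) (F ps₀ k₀ ∈_)
  derive base step =
    identity pA A≤W eA [] >>= λ π₁ _ hA →
    identity pB B≤W eB π₁ >>= λ π₂ keep₂ hB →
    row base step ps₀ 0 (≤-reflexive (+-identityʳ n)) π₂ (keep₂ hA , hB) >>= λ π₃ _ r →
    return π₃ (r 0 (s≤s z≤n))

  provable : ∀ {F Γ D Δ} → Base F → Step F → F ps₀ k₀ ≋ (Γ ⇒ (D ∷ Δ)) →
             Fits (Γ ⇒ (D ∷ D ∷ Δ)) → Fits (Γ ⇒ (D ∷ Δ)) →
             bv ps₀ k₀ A B ∈ Γ ⊎ bv ps₀ k₀ A B ∈ (D ∷ Δ) → PolyProvable 1075 3 Ax (Γ ⇒ (D ∷ Δ))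
  provable base step F≋S fit₂ fit₁ occurs =
    let π , size≤ = conclude (derive base step) F≋S fit₂ fit₁ in
    π , ≤-trans size≤ (cubicBound A≤W B≤W 1+n≤W
                         (≤-trans (+-monoˡ-≤ (sizeAx Ax) (size≤sizeSeq occurs)) (n≤1+n _)))

  F₁ F₂ F₃ F₄ : Family
  F₁ ps k = (bv ps k A B ∷ []) ⇒ (tv ps k ∷ A ∷ [])
  F₂ ps k = (bv ps k A B ∷ []) ⇒ (A ∷ B ∷ [])
  F₃ ps k = (A ∷ []) ⇒ (bv ps k A B ∷ [])
  F₄ ps k = (tv ps k ∷ B ∷ []) ⇒ (bv ps k A B ∷ [])

  base₁ : Base F₁
  base₁ π _ k with k ≟ℤ + 0
  ... | yes refl = weaken ≤-eval (
    line π (fits [] (s1 ∷ [])) (init ini1 ≋-refl) >>= λ π₁ _ h₁ →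
    axiomCutʳ s1 st ([] , [] , z≤n) (tdef₂ t-ε0) π₁ h₁ >>= λ π₂ _ h₂ →
    line π₂ (fits [] (st ∷ sA ∷ [])) (rule1 h₂ ≋-refl (wkR A) (refl , swap A _ refl)) >>= λ π₃ _ h₃ →
    line π₃ (fits (sbv z≤n ∷ []) (st ∷ sA ∷ [])) (by₁ (wkL _) h₃))
    where
    s1 = unit-small c1 ≤-refl
    st = stv z≤n
  ... | no k≢0 = weaken ≤-eval (
    line π (fits (sbv z≤n ∷ []) (sA ∷ [])) (axiom (tdef₁ (b-εk pA pB k≢0)) ≋-refl) >>= λ π₁ _ h₁ →
    line π₁ (fits (sbv z≤n ∷ []) (stv z≤n ∷ sA ∷ [])) (by₁ (wkR _) h₁))

  step₁ : Step F₁
  step₁ π p ps k ℓ h h' =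
    pdR-else p sDt (sbv ℓ' ∷ [] , sA ∷ [] , ≤-eval) π h >>= λ π₁ keep₁ g₁ →
    pdR-then p sDt (sbv ℓ' ∷ [] , sA ∷ [] , ≤-eval) π₁ (keep₁ h') >>= λ π₂ keep₂ g₂ →
    line π₂ (fits (sDbv ℓ ∷ []) (sDt ∷ sA ∷ [])) (by₂ pdL (keep₂ g₁) g₂) >>= λ π₃ _ g₃ →
    axiomCutˡ (sbv ℓ) (sDbv ℓ) ([] , sDt ∷ sA ∷ [] , ≤-eval) (tdef₁ (b-∷ p ps k pA pB)) π₃ g₃ >>= λ π₄ _ g₄ →
    axiomCutʳ sDt (stv ℓ) (sbv ℓ ∷ [] , sA ∷ [] , ≤-eval) (tdef₂ (t-∷ p ps k)) π₄ g₄
    where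
    ℓ' = ≤-trans (n≤1+n _) ℓ
    sDt = sDtv ℓ

  base₂ : Base F₂
  base₂ π (iA , iB) k with k ≟ℤ + 0
  ... | yes refl = weaken ≤-eval (
    line π (fits (sA ∷ []) (sA ∷ sB ∷ []))
      (rule1 iA ≋-refl (wkR B) (refl , swap B A refl)) >>= λ π₁ keep₁ h₁ →
    line π₁ (fits (sB ∷ []) (sA ∷ sB ∷ [])) (by₁ (wkR A) (keep₁ iB)) >>= λ π₂ keep₂ h₂ →
    line π₂ (fits (sA∨B ∷ []) (sA ∷ sB ∷ [])) (by₂ orL (keep₂ h₁) h₂) >>= λ π₃ _ h₃ →
    axiomCutˡ (sbv z≤n) sA∨B ([] , sA ∷ sB ∷ [] , ≤-eval) (tdef₁ (b-ε0 pA pB)) π₃ h₃)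
  ... | no k≢0 = weaken ≤-eval (
    line π (fits (sbv z≤n ∷ []) (sA ∷ [])) (axiom (tdef₁ (b-εk pA pB k≢0)) ≋-refl) >>= λ π₁ _ h₁ →
    line π₁ (fits (sbv z≤n ∷ []) (sA ∷ sB ∷ [])) (rule1 h₁ ≋-refl (wkR B) (refl , swap B A refl)))

  step₂ : Step F₂
  step₂ π p ps k ℓ h h' = weaken ≤-eval (
    line π (fits (svar ∷ sbv ℓ' ∷ []) (sA ∷ sB ∷ [])) (by₁ (wkL (var p)) h') >>= λ π₁ keep₁ g₁ →
    line π₁ (fits (sDbv ℓ ∷ []) (sA ∷ sB ∷ [])) (by₂ pdL (keep₁ h) g₁) >>= λ π₂ _ g₂ →
    axiomCutˡ (sbv ℓ) (sDbv ℓ) ([] , sA ∷ sB ∷ [] , ≤-eval) (tdef₁ (b-∷ p ps k pA pB)) π₂ g₂)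
    where
    ℓ' = ≤-trans (n≤1+n _) ℓ
    svar = unit-small (var p) ≤-refl

  base₃ : Base F₃
  base₃ π (iA , _) k with k ≟ℤ + 0
  ... | yes refl = weaken ≤-eval (
    line π (fits (sA ∷ []) (sA ∷ sB ∷ [])) (rule1 iA ≋-refl (wkR B) (refl , swap B A refl)) >>= λ π₁ _ h₁ →
    line π₁ (fits (sA ∷ []) (sA∨B ∷ [])) (by₁ orR h₁) >>= λ π₂ _ h₂ →
    axiomCutʳ sA∨B (sbv z≤n) (sA ∷ [] , [] , ≤-eval) (tdef₂ (b-ε0 pA pB)) π₂ h₂)
  ... | no k≢0 = weaken ≤-eval (
    line π (fits (sA ∷ []) (sbv z≤n ∷ [])) (axiom (tdef₂ (b-εk pA pB k≢0)) ≋-refl))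

  step₃ : Step F₃
  step₃ π p ps k ℓ h _ = weaken ≤-eval (
    pdR-else p (sDbv ℓ) (sA ∷ [] , [] , ≤-eval) π h >>= λ π₁ _ g₁ →
    axiomCutʳ (sDbv ℓ) (sbv ℓ) (sA ∷ [] , [] , ≤-eval) (tdef₂ (b-∷ p ps k pA pB)) π₁ g₁)

  base₄ : Base F₄
  base₄ π (_ , iB) k with k ≟ℤ + 0
  ... | yes refl = weaken ≤-eval (
    line π (fits (sB ∷ []) (sA ∷ sB ∷ [])) (by₁ (wkR A) iB) >>= λ π₁ _ h₁ →
    line π₁ (fits (sB ∷ []) (sA∨B ∷ [])) (by₁ orR h₁) >>= λ π₂ _ h₂ →
    axiomCutʳ sA∨B (sbv z≤n) (sB ∷ [] , [] , ≤-eval) (tdef₂ (b-ε0 pA pB)) π₂ h₂ >>= λ π₃ _ h₃ →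
    line π₃ (fits (stv z≤n ∷ sB ∷ []) (sbv z≤n ∷ [])) (by₁ (wkL _) h₃))
  ... | no k≢0 = weaken ≤-eval (
    line π (fits (s0 ∷ []) []) (init ini0 ≋-refl) >>= λ π₁ _ h₁ →
    axiomCutˡ (stv z≤n) s0 ([] , [] , z≤n) (tdef₁ (t-εk k≢0)) π₁ h₁ >>= λ π₂ _ h₂ →
    line π₂ (fits (stv z≤n ∷ sB ∷ []) []) (rule1 h₂ ≋-refl (wkL B) (swap B _ refl , refl)) >>= λ π₃ _ h₃ →
    line π₃ (fits (stv z≤n ∷ sB ∷ []) (sbv z≤n ∷ [])) (by₁ (wkR _) h₃))
    where s0 = unit-small c0 ≤-refl

  step₄ : Step F₄
  step₄ π p ps k ℓ h h' =
    pdR-else p sDb (stv ℓ' ∷ sB ∷ [] , [] , ≤-eval) π h >>= λ π₁ keep₁ g₁ →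
    pdR-then p sDb (stv ℓ' ∷ sB ∷ [] , [] , ≤-eval) π₁ (keep₁ h') >>= λ π₂ keep₂ g₂ →
    line π₂ (fits (sDtv ℓ ∷ sB ∷ []) (sDb ∷ [])) (by₂ pdL (keep₂ g₁) g₂) >>= λ π₃ _ g₃ →
    axiomCutˡ (stv ℓ) (sDtv ℓ) (sB ∷ [] , sDb ∷ [] , ≤-eval) (tdef₁ (t-∷ p ps k)) π₃ g₃ >>= λ π₄ _ g₄ →
    axiomCutʳ sDb (sbv ℓ) (stv ℓ ∷ sB ∷ [] , [] , ≤-eval) (tdef₂ (b-∷ p ps k pA pB)) π₄ g₄
    where
    ℓ' = ≤-trans (n≤1+n _) ℓ
    sDb = sDbv ℓ

  b₀ : Small (bv ps₀ k₀ A B)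
  b₀ = sbv ≤-refl

  t₀ : Small (tv ps₀ k₀)
  t₀ = stv ≤-refl

  part₁ : PolyProvable 1075 3 Ax ((bv ps₀ k₀ A B ∷ []) ⇒ (A ∷ tv ps₀ k₀ ∷ []))
  part₁ = provable base₁ step₁ (refl , swap _ _ refl)
            (fits (b₀ ∷ []) (sA ∷ sA ∷ t₀ ∷ [])) (fits (b₀ ∷ []) (sA ∷ t₀ ∷ [])) (inj₁ (here refl))

  part₂ : PolyProvable 1075 3 Ax ((bv ps₀ k₀ A B ∷ []) ⇒ (A ∷ B ∷ []))
  part₂ = provable base₂ step₂ ≋-refl
            (fits (b₀ ∷ []) (sA ∷ sA ∷ sB ∷ [])) (fits (b₀ ∷ []) (sA ∷ sB ∷ [])) (inj₁ (here refl))

  part₃ : PolyProvable 1075 3 Ax ((A ∷ []) ⇒ (bv ps₀ k₀ A B ∷ []))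
  part₃ = provable base₃ step₃ ≋-refl
            (fits (sA ∷ []) (b₀ ∷ b₀ ∷ [])) (fits (sA ∷ []) (b₀ ∷ [])) (inj₂ (here refl))

  part₄ : PolyProvable 1075 3 Ax ((tv ps₀ k₀ ∷ B ∷ []) ⇒ (bv ps₀ k₀ A B ∷ []))
  part₄ = provable base₄ step₄ ≋-refl
            (fits (t₀ ∷ sB ∷ []) (b₀ ∷ b₀ ∷ [])) (fits (t₀ ∷ sB ∷ []) (b₀ ∷ [])) (inj₂ (here refl))

mainTheorem14 : Σ ℕ λ c → Σ ℕ λ d →
    (ps : List PVar) (k : ℤ) (A B : Formula) (Ax : List Formula) →
    Pos A → Pos B → WellFounded Ax →
    ExtBelow (length Ax) A → ExtBelow (length Ax) B →
      PolyProvable c d Ax ((bv ps k A B ∷ []) ⇒ (A ∷ tv ps k ∷ []))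
    × PolyProvable c d Ax ((bv ps k A B ∷ []) ⇒ (A ∷ B ∷ []))
    × PolyProvable c d Ax ((A ∷ []) ⇒ (bv ps k A B ∷ []))
    × PolyProvable c d Ax ((tv ps k ∷ B ∷ []) ⇒ (bv ps k A B ∷ []))
mainTheorem14 = 1075 , 3 , λ ps k A B Ax pA pB wf eA eB →
  let open Families Ax pA pB wf eA eB ps k in part₁ , part₂ , part₃ , part₄
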